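{- Let $K$ be a field of characteristic $0$. Let $M=(\mu_0,\mu_1,\ldots,\mu_n)$ be a multiplicity vector, let $\lambda\in K$, and let $f(x)=\sum_{j=0}^n c_j(x-\lambda)^j\in K[x]$ be a polynomial of degree $n$. Then $M$ equals the multiplicity vector $M_f(\lambda)$ of $f$ at $\lambda$ if and only if, for every $j\in\{0,1,\ldots,n\}$, $c_j=0$ holds exactly when $\mu_j\ge 1$.
   Context: A multiplicity vector is a vector $(\mu_0,\ldots,\mu_n)$ of nonnegative integers with $\mu_n=0$ such that $\mu_j\ge1$ implies $\mu_{j+1}=\mu_j-1$. For a polynomial $f$ of degree $n$ and $\lambda\in K$, the multiplicity vector of $f$ at $\lambda$ is $M_f(\lambda)=(\mu_0,\ldots,\mu_n)$ where $\mu_j$ is the multiplicity of $\lambda$ as a zero of the $j$th derivative $f^{(j)}(x)$ (multiplicity $0$ if $f^{(j)}(\lambda)\neq0$; otherwise the largest $\mu$ with $(x-\lambda)^\mu\mid f^{(j)}(x)$). -}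

module Defs where

open import Level using (Level; _⊔_)
open import Algebra.Bundles using (CommutativeRing; Semiring)
open import Data.Nat using (ℕ; zero; suc; _≤_; _<_)
open import Data.Fin using (Fin; toℕ; fromℕ; inject₁) renaming (suc to fsuc)
open import Data.List using (List; []; _∷_; map; foldr; allFin)
open import Data.Product using (Σ; _×_; _,_; ∃)
open import Relation.Nullary using (¬_)
open import Relation.Binary.PropositionalEquality using (_≡_)
import Algebra.Definitions.RawSemiring as RawSemiringDefs

-- Fields (the standard library has no Field bundle):
-- a commutative ring with 1 ≉ 0 in which every nonzero element is invertible.

record Field (c ℓ : Level) : Set (Level.suc (c ⊔ ℓ)) where
  field
    commutativeRing : CommutativeRing c ℓ
  open CommutativeRing commutativeRing public
  field
    1≉0     : ¬ (1# ≈ 0#)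
    inverse : ∀ x → ¬ (x ≈ 0#) → ∃ λ y → (x * y) ≈ 1#

module FieldTheory {c ℓ : Level} (K : Field c ℓ) where
  open Field K
  open RawSemiringDefs (Semiring.rawSemiring (CommutativeRing.semiring commutativeRing)) using () renaming (_×_ to _·ℕ_) public

  CharZero : Set ℓ
  CharZero = ∀ n → ¬ ((suc n ·ℕ 1#) ≈ 0#)

  -- Polynomials in K[x] as coefficient lists (constant term first);
  -- equality is coefficientwise (so trailing zeros are irrelevant).

  Poly : Set c
  Poly = List Carrier

  coeff : Poly → ℕ → Carrier
  coeff []       _       = 0#
  coeff (a ∷ p)  zero    = a
  coeff (a ∷ p)  (suc i) = coeff p i

  _≈ₚ_ : Poly → Poly → Set ℓ
  p ≈ₚ q = ∀ i → coeff p i ≈ coeff q i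

  _+ₚ_ : Poly → Poly → Poly
  []      +ₚ q       = q
  (a ∷ p) +ₚ []      = a ∷ p
  (a ∷ p) +ₚ (b ∷ q) = (a + b) ∷ (p +ₚ q)

  _·ₚ_ : Carrier → Poly → Poly
  a ·ₚ p = map (a *_) p

  _*ₚ_ : Poly → Poly → Poly
  []      *ₚ q = []
  (a ∷ p) *ₚ q = (a ·ₚ q) +ₚ (0# ∷ (p *ₚ q))

  oneₚ : Poly
  oneₚ = 1# ∷ []

  _^ₚ_ : Poly → ℕ → Poly
  p ^ₚ zero  = oneₚ
  p ^ₚ suc k = p *ₚ (p ^ₚ k)

  X-_ : Carrier → Poly
  X- a = (- a) ∷ 1# ∷ []

  HasDegree : Poly → ℕ → Set ℓ
  HasDegree p n = ¬ (coeff p n ≈ 0#) × (∀ i → n < i → coeff p i ≈ 0#)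

  -- formal derivative: (Σ aᵢ xⁱ)' = Σ (i+1)·a_{i+1} xⁱ
  derivAux : ℕ → Poly → Poly
  derivAux k []      = []
  derivAux k (a ∷ p) = (k ·ℕ a) ∷ derivAux (suc k) p

  deriv : Poly → Poly
  deriv []      = []
  deriv (a ∷ p) = derivAux 1 p

  deriv^ : ℕ → Poly → Poly
  deriv^ zero    p = p
  deriv^ (suc j) p = deriv (deriv^ j p)

  _∣ₚ_ : Poly → Poly → Set (c ⊔ ℓ)
  d ∣ₚ g = ∃ λ q → g ≈ₚ (d *ₚ q)

  -- μ is the multiplicity of λ as a zero of g: the largest μ with (x-λ)^μ ∣ g
  -- (for g(λ) ≠ 0 this is 0, as (x-λ)^0 = 1 always divides g)
  IsMultiplicity : Poly → Carrier → ℕ → Set (c ⊔ ℓ)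
  IsMultiplicity g lam μ =
    ((X- lam) ^ₚ μ) ∣ₚ g × (∀ ν → ((X- lam) ^ₚ ν) ∣ₚ g → ν ≤ μ)

  shiftedPoly : {n : ℕ} → Carrier → (Fin (suc n) → Carrier) → Poly
  shiftedPoly {n} lam cs =
    foldr (λ j acc → (cs j ·ₚ ((X- lam) ^ₚ toℕ j)) +ₚ acc) [] (allFin (suc n))

  IsMultVectorOf : {n : ℕ} → (Fin (suc n) → ℕ) → Poly → Carrier → Set (c ⊔ ℓ)
  IsMultVectorOf {n} M f lam = ∀ (j : Fin (suc n)) → IsMultiplicity (deriv^ (toℕ j) f) lam (M j)

IsMultiplicityVector : {n : ℕ} → (Fin (suc n) → ℕ) → Set
IsMultiplicityVector {n} M =
  M (fromℕ n) ≡ 0 × (∀ (j : Fin n) → 1 ≤ M (inject₁ j) → M (fsuc j) ≡ Data.Nat._∸_ (M (inject₁ j)) 1)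

-- Write f = Σᵢ cᵢ (x − λ)ⁱ. The multiplicity of λ as a root of such a sum is the index of
-- its first nonzero coefficient: evaluating at λ gives c₀, and x − λ can be cancelled.
-- Differentiating termwise, f⁽ʲ⁾ = Σᵢ (i+1)⋯(i+j) c_{i+j} (x − λ)ⁱ, and in characteristic 0
-- these coefficients vanish exactly when c_{i+j} does. So M_f(λ)_j is the length of the run
-- of zeros c_j, c_{j+1}, … ; along a multiplicity vector μ_{j+1} = μ_j − 1 as long as
-- μ_j ≥ 1, so the run lengths are all correct iff c_j = 0 exactly when μ_j ≥ 1.

module Submission where

open import Level using (Level)
open import Data.Nat using (ℕ; zero; suc; _≤_; _<_; _∸_; z≤n; s≤s)
import Data.Nat as ℕ
import Data.Nat.Properties as ℕ
open import Data.Fin using (Fin; toℕ; inject₁) renaming (zero to fzero; suc to fsuc)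
open import Data.Fin.Properties using (toℕ-inject₁)
open import Data.Fin.Relation.Unary.Top using (view; ‵fromℕ; ‵inject₁)
open import Data.List using (List; []; _∷_; length; drop; foldr; tabulate)
open import Data.Maybe using (nothing)
open import Data.Product using (_×_; _,_; proj₁; proj₂)
open import Data.Product.Function.NonDependent.Propositional using (_×-⇔_)
open import Data.Sum using (inj₁; inj₂)
open import Function.Base using (_∘_; id)
open import Function.Bundles using (_⇔_; mk⇔; Equivalence)
open import Function.Construct.Identity using (⇔-id)
open import Function.Construct.Symmetry using (⇔-sym)
open import Function.Construct.Composition using (_⇔-∘_)
open import Function.Related.Propositional using (module EquationalReasoning; K-reflexive)
open import Relation.Nullary using (¬_; contradiction)
open import Relation.Binary.Bundles using (Setoid)
import Relation.Binary.PropositionalEquality as ≡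
open ≡ using (_≡_)
import Relation.Binary.Reasoning.Setoid
open import Defs

open Equivalence using (to; from)

∀-⇔ : ∀ {i a b} {I : Set i} {A : I → Set a} {B : I → Set b} → (∀ x → A x ⇔ B x) → (∀ x → A x) ⇔ (∀ x → B x)
∀-⇔ A⇔B = mk⇔ (λ f x → to (A⇔B x) (f x)) (λ g x → from (A⇔B x) (g x))

AllBelow : ∀ {a} → (ℕ → Set a) → ℕ → Set a
AllBelow Z μ = ∀ i → i < μ → Z i

RunLength : ∀ {a} → (ℕ → Set a) → ℕ → Set a
RunLength Z μ = AllBelow Z μ × ¬ Z μ

RunLength-cong : ∀ {a b μ} {Z : ℕ → Set a} {Z′ : ℕ → Set b} →
                 (∀ i → Z i ⇔ Z′ i) → RunLength Z μ ⇔ RunLength Z′ μ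
RunLength-cong Z⇔Z′ = mk⇔
  (λ (zs , nz) → (λ i i<μ → to (Z⇔Z′ i) (zs i i<μ)) , λ z → nz (from (Z⇔Z′ _) z))
  (λ (zs , nz) → (λ i i<μ → from (Z⇔Z′ i) (zs i i<μ)) , λ z → nz (to (Z⇔Z′ _) z))

module _ {a} {Z : ℕ → Set a} where

  AllBelow-suc⇔ : ∀ {μ} → AllBelow Z (suc μ) ⇔ (Z 0 × AllBelow (Z ∘ suc) μ)
  AllBelow-suc⇔ = mk⇔ (λ zs → zs 0 (s≤s z≤n) , λ i i<μ → zs (suc i) (s≤s i<μ))
                      λ { (z₀ , zs) zero _ → z₀ ; (z₀ , zs) (suc i) (s≤s i<μ) → zs i i<μ }

  AllBelow-extend : ∀ {μ} → AllBelow Z μ → Z μ → AllBelow Z (suc μ)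
  AllBelow-extend zs zμ i (s≤s i≤μ) with ℕ.m≤n⇒m<n∨m≡n i≤μ
  ... | inj₁ i<μ  = zs i i<μ
  ... | inj₂ ≡.refl = zμ

  RunLength-suc : ∀ {μ} → Z 0 → RunLength (Z ∘ suc) μ → RunLength Z (suc μ)
  RunLength-suc z₀ (zs , nz) = from AllBelow-suc⇔ (z₀ , zs) , nz

  RunLength-head⇔ : ∀ {μ} → RunLength Z μ → (Z 0 ⇔ 1 ≤ μ)
  RunLength-head⇔ {zero}  (_ , nz)  = mk⇔ (λ z₀ → contradiction z₀ nz) λ ()
  RunLength-head⇔ {suc μ} (zs , _) = mk⇔ (λ _ → s≤s z≤n) (λ _ → zs 0 (s≤s z≤n))

  greatest⇔RunLength : ∀ {d} {D : ℕ → Set d} → (∀ ν → D ν ⇔ AllBelow Z ν) →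
                       ∀ μ → (D μ × (∀ ν → D ν → ν ≤ μ)) ⇔ RunLength Z μ
  greatest⇔RunLength D⇔ μ = mk⇔
    (λ (dμ , greatest) → to (D⇔ μ) dμ ,
       λ zμ → ℕ.1+n≰n (greatest (suc μ) (from (D⇔ (suc μ)) (AllBelow-extend (to (D⇔ μ) dμ) zμ))))
    (λ (zs , nz) → from (D⇔ μ) zs ,
       λ ν dν → ℕ.≮⇒≥ (λ μ<ν → nz (to (D⇔ ν) dν μ μ<ν)))

module _ {a} {n : ℕ} {M : Fin (suc n) → ℕ} (isMV : IsMultiplicityVector M) {Z : ℕ → Set a} where

  private
    Run : Fin (suc n) → Set a
    Run j = RunLength (λ i → Z (i ℕ.+ toℕ j)) (M j)

  runLengths⇐heads : (∀ j → Z (toℕ j) ⇔ 1 ≤ M j) → ∀ j → Run j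
  runLengths⇐heads heads j = go (M j) j ≡.refl
    where
    go : ∀ m j → M j ≡ m → RunLength (λ i → Z (i ℕ.+ toℕ j)) m
    go zero    j Mj≡0   = (λ _ ()) , λ z → contradiction (≡.subst (1 ≤_) Mj≡0 (to (heads j) z)) λ ()
    go (suc m) j Mj≡1+m with view j
    ... | ‵fromℕ      = contradiction (≡.trans (≡.sym (proj₁ isMV)) Mj≡1+m) λ ()
    ... | ‵inject₁ j′ = RunLength-suc (from (heads (inject₁ j′)) 1≤Mj)
                          (to (RunLength-cong shift) (go m (fsuc j′) (≡.trans (proj₂ isMV j′ 1≤Mj) (≡.cong (_∸ 1) Mj≡1+m))))
      where
      1≤Mj : 1 ≤ M (inject₁ j′)
      1≤Mj = ≡.subst (1 ≤_) (≡.sym Mj≡1+m) (s≤s z≤n)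
      shift : ∀ i → Z (i ℕ.+ suc (toℕ j′)) ⇔ Z (suc i ℕ.+ toℕ (inject₁ j′))
      shift i rewrite toℕ-inject₁ j′ | ℕ.+-suc i (toℕ j′) = ⇔-id _

  runLengths⇔heads : (∀ j → Run j) ⇔ (∀ j → Z (toℕ j) ⇔ 1 ≤ M j)
  runLengths⇔heads = mk⇔ (λ runs j → RunLength-head⇔ (runs j)) runLengths⇐heads

module Polynomials {c ℓ} (K : Field c ℓ) where
  open Field K hiding (zero)
  open FieldTheory K
  module ≈-Reasoning = Relation.Binary.Reasoning.Setoid setoid
  open import Tactic.RingSolver.Core.AlmostCommutativeRing using (fromCommutativeRing)
  -- no decidable zero test is supplied, so the solver cannot cancel - x against x: such steps
  -- go through -x*y+x*y≈0 instead
  open import Tactic.RingSolver.NonReflective (fromCommutativeRing commutativeRing (λ _ → nothing))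
    using (solve; _⊜_; _⊕_; _⊗_)
  open import Algebra.Properties.Semiring.Mult semiring using (×-congʳ; ×-assoc-*)

  -x*y+x*y≈0 : ∀ x y → (- x) * y + x * y ≈ 0#
  -x*y+x*y≈0 x y = trans (sym (distribʳ y (- x) x)) (trans (*-congʳ (-‿inverseˡ x)) (zeroˡ y))

  x≉0∧x*y≈0⇒y≈0 : ∀ {x y} → ¬ x ≈ 0# → x * y ≈ 0# → y ≈ 0#
  x≉0∧x*y≈0⇒y≈0 {x} {y} x≉0 xy≈0 with inverse x x≉0
  ... | x⁻¹ , xx⁻¹≈1 = begin
    y               ≈⟨ *-identityˡ y ⟨
    1# * y          ≈⟨ *-congʳ (trans (sym xx⁻¹≈1) (*-comm x x⁻¹)) ⟩
    (x⁻¹ * x) * y   ≈⟨ *-assoc x⁻¹ x y ⟩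
    x⁻¹ * (x * y)   ≈⟨ *-congˡ xy≈0 ⟩
    x⁻¹ * 0#        ≈⟨ zeroʳ x⁻¹ ⟩
    0#              ∎
    where open ≈-Reasoning

  -- a record rather than _≈ₚ_ itself, so that both polynomials can be inferred from a proof
  infix 4 _≋_
  record _≋_ (p q : Poly) : Set ℓ where
    constructor coeffwise
    field at : p ≈ₚ q
  open _≋_ public

  ≋-setoid : Setoid c ℓ
  ≋-setoid = record
    { Carrier = Poly ; _≈_ = _≋_
    ; isEquivalence = record
      { refl  = coeffwise λ _ → refl
      ; sym   = λ e → coeffwise λ i → sym (at e i)
      ; trans = λ e f → coeffwise λ i → trans (at e i) (at f i) } }

  open Setoid ≋-setoid public using () renaming (refl to ≋-refl; sym to ≋-sym; trans to ≋-trans; reflexive to ≋-reflexive)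
  module ≋-Reasoning = Relation.Binary.Reasoning.Setoid ≋-setoid

  coeff-+ₚ : ∀ p q i → coeff (p +ₚ q) i ≈ coeff p i + coeff q i
  coeff-+ₚ []      q       i       = sym (+-identityˡ _)
  coeff-+ₚ (a ∷ p) []      i       = sym (+-identityʳ _)
  coeff-+ₚ (a ∷ p) (b ∷ q) zero    = refl
  coeff-+ₚ (a ∷ p) (b ∷ q) (suc i) = coeff-+ₚ p q i

  coeff-·ₚ : ∀ a p i → coeff (a ·ₚ p) i ≈ a * coeff p i
  coeff-·ₚ a []      i       = sym (zeroʳ a)
  coeff-·ₚ a (b ∷ p) zero    = refl
  coeff-·ₚ a (b ∷ p) (suc i) = coeff-·ₚ a p i

  ∷-cong : ∀ {a b p q} → a ≈ b → p ≋ q → (a ∷ p) ≋ (b ∷ q)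
  ∷-cong a≈b p≋q = coeffwise λ { zero → a≈b ; (suc i) → at p≋q i }

  ∷-injectiveʳ : ∀ {a b p q} → (a ∷ p) ≋ (b ∷ q) → p ≋ q
  ∷-injectiveʳ e = coeffwise (at e ∘ suc)

  0∷[]≋[] : (0# ∷ []) ≋ []
  0∷[]≋[] = coeffwise λ { zero → refl ; (suc i) → refl }

  +ₚ-cong : ∀ {p p′ q q′} → p ≋ p′ → q ≋ q′ → (p +ₚ q) ≋ (p′ +ₚ q′)
  +ₚ-cong {p} {p′} {q} {q′} e f = coeffwise λ i →
    trans (coeff-+ₚ p q i) (trans (+-cong (at e i) (at f i)) (sym (coeff-+ₚ p′ q′ i)))

  ·ₚ-cong : ∀ {a b p q} → a ≈ b → p ≋ q → (a ·ₚ p) ≋ (b ·ₚ q)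
  ·ₚ-cong {a} {b} {p} {q} e f = coeffwise λ i →
    trans (coeff-·ₚ a p i) (trans (*-cong e (at f i)) (sym (coeff-·ₚ b q i)))

  +ₚ-identityʳ : ∀ p → (p +ₚ []) ≡ p
  +ₚ-identityʳ []      = ≡.refl
  +ₚ-identityʳ (a ∷ p) = ≡.refl

  ·ₚ-zeroˡ : ∀ p → (0# ·ₚ p) ≋ []
  ·ₚ-zeroˡ p = coeffwise λ i → trans (coeff-·ₚ 0# p i) (zeroˡ _)

  ·ₚ-identityˡ : ∀ p → (1# ·ₚ p) ≋ p
  ·ₚ-identityˡ p = coeffwise λ i → trans (coeff-·ₚ 1# p i) (*-identityˡ _)

  ·ₚ-distribʳ : ∀ a b p → ((a + b) ·ₚ p) ≋ ((a ·ₚ p) +ₚ (b ·ₚ p))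
  ·ₚ-distribʳ a b p = coeffwise λ i → trans (coeff-·ₚ (a + b) p i) (trans (distribʳ _ a b)
    (sym (trans (coeff-+ₚ (a ·ₚ p) (b ·ₚ p) i) (+-cong (coeff-·ₚ a p i) (coeff-·ₚ b p i)))))

  ·ₚ-distribˡ : ∀ a p q → (a ·ₚ (p +ₚ q)) ≋ ((a ·ₚ p) +ₚ (a ·ₚ q))
  ·ₚ-distribˡ a p q = coeffwise λ i → trans (coeff-·ₚ a (p +ₚ q) i) (trans (*-congˡ (coeff-+ₚ p q i))
    (trans (distribˡ a _ _) (sym (trans (coeff-+ₚ (a ·ₚ p) (a ·ₚ q) i) (+-cong (coeff-·ₚ a p i) (coeff-·ₚ a q i))))))

  ·ₚ-assoc : ∀ a b p → (a ·ₚ (b ·ₚ p)) ≋ ((a * b) ·ₚ p)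
  ·ₚ-assoc a b p = coeffwise λ i → trans (coeff-·ₚ a (b ·ₚ p) i)
    (trans (*-congˡ (coeff-·ₚ b p i)) (trans (sym (*-assoc a b _)) (sym (coeff-·ₚ (a * b) p i))))

  ·ₚ-comm : ∀ a b p → (a ·ₚ (b ·ₚ p)) ≋ (b ·ₚ (a ·ₚ p))
  ·ₚ-comm a b p = ≋-trans (·ₚ-assoc a b p) (≋-trans (·ₚ-cong (*-comm a b) ≋-refl) (≋-sym (·ₚ-assoc b a p)))

  +ₚ-interchange : ∀ p q r s → ((p +ₚ q) +ₚ (r +ₚ s)) ≋ ((p +ₚ r) +ₚ (q +ₚ s))
  +ₚ-interchange p q r s = coeffwise λ i →
    trans (coeff-+ₚ (p +ₚ q) (r +ₚ s) i) (trans (+-cong (coeff-+ₚ p q i) (coeff-+ₚ r s i))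
      (trans (solve 4 (λ a b c d → ((a ⊕ b) ⊕ (c ⊕ d)) ⊜ ((a ⊕ c) ⊕ (b ⊕ d))) refl (coeff p i) (coeff q i) (coeff r i) (coeff s i))
        (sym (trans (coeff-+ₚ (p +ₚ r) (q +ₚ s) i) (+-cong (coeff-+ₚ p r i) (coeff-+ₚ q s i))))))

  0∷-+ₚ : ∀ p q → (0# ∷ (p +ₚ q)) ≋ ((0# ∷ p) +ₚ (0# ∷ q))
  0∷-+ₚ p q = ∷-cong (sym (+-identityʳ 0#)) ≋-refl

  *ₚ-congʳ : ∀ p {q q′} → q ≋ q′ → (p *ₚ q) ≋ (p *ₚ q′)
  *ₚ-congʳ []      e = ≋-refl
  *ₚ-congʳ (a ∷ p) e = +ₚ-cong (·ₚ-cong refl e) (∷-cong refl (*ₚ-congʳ p e))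

  *ₚ-identityˡ : ∀ q → (oneₚ *ₚ q) ≋ q
  *ₚ-identityˡ q = ≋-trans (+ₚ-cong (·ₚ-identityˡ q) 0∷[]≋[]) (≋-reflexive (+ₚ-identityʳ q))

  0∷-*ₚ : ∀ p q → ((0# ∷ p) *ₚ q) ≋ (0# ∷ (p *ₚ q))
  0∷-*ₚ p q = +ₚ-cong {q = 0# ∷ (p *ₚ q)} (·ₚ-zeroˡ q) ≋-refl

  *ₚ-distribʳ : ∀ p p′ q → ((p +ₚ p′) *ₚ q) ≋ ((p *ₚ q) +ₚ (p′ *ₚ q))
  *ₚ-distribʳ []      p′       q = ≋-refl
  *ₚ-distribʳ (a ∷ p) []       q = ≋-reflexive (≡.sym (+ₚ-identityʳ _))
  *ₚ-distribʳ (a ∷ p) (b ∷ p′) q =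
    ≋-trans (+ₚ-cong (·ₚ-distribʳ a b q) (≋-trans (∷-cong refl (*ₚ-distribʳ p p′ q)) (0∷-+ₚ (p *ₚ q) (p′ *ₚ q))))
      (+ₚ-interchange (a ·ₚ q) (b ·ₚ q) (0# ∷ (p *ₚ q)) (0# ∷ (p′ *ₚ q)))

  *ₚ-distribˡ : ∀ p q q′ → (p *ₚ (q +ₚ q′)) ≋ ((p *ₚ q) +ₚ (p *ₚ q′))
  *ₚ-distribˡ []      q q′ = ≋-refl
  *ₚ-distribˡ (a ∷ p) q q′ =
    ≋-trans (+ₚ-cong (·ₚ-distribˡ a q q′) (≋-trans (∷-cong refl (*ₚ-distribˡ p q q′)) (0∷-+ₚ (p *ₚ q) (p *ₚ q′))))
      (+ₚ-interchange (a ·ₚ q) (a ·ₚ q′) (0# ∷ (p *ₚ q)) (0# ∷ (p *ₚ q′)))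

  *ₚ-·ₚˡ : ∀ a p q → ((a ·ₚ p) *ₚ q) ≋ (a ·ₚ (p *ₚ q))
  *ₚ-·ₚˡ a []      q = ≋-refl
  *ₚ-·ₚˡ a (b ∷ p) q =
    ≋-trans (+ₚ-cong (≋-sym (·ₚ-assoc a b q)) (∷-cong (sym (zeroʳ a)) (*ₚ-·ₚˡ a p q)))
      (≋-sym (·ₚ-distribˡ a (b ·ₚ q) (0# ∷ (p *ₚ q))))

  *ₚ-·ₚʳ : ∀ a p q → (p *ₚ (a ·ₚ q)) ≋ (a ·ₚ (p *ₚ q))
  *ₚ-·ₚʳ a []      q = ≋-refl
  *ₚ-·ₚʳ a (b ∷ p) q =
    ≋-trans (+ₚ-cong (·ₚ-comm b a q) (∷-cong (sym (zeroʳ a)) (*ₚ-·ₚʳ a p q)))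
      (≋-sym (·ₚ-distribˡ a (b ·ₚ q) (0# ∷ (p *ₚ q))))

  *ₚ-assoc : ∀ p q r → ((p *ₚ q) *ₚ r) ≋ (p *ₚ (q *ₚ r))
  *ₚ-assoc []      q r = ≋-refl
  *ₚ-assoc (a ∷ p) q r =
    ≋-trans (*ₚ-distribʳ (a ·ₚ q) (0# ∷ (p *ₚ q)) r)
      (+ₚ-cong (*ₚ-·ₚˡ a q r) (≋-trans (0∷-*ₚ (p *ₚ q) r) (∷-cong refl (*ₚ-assoc p q r))))

  *ₚ-zeroʳ : ∀ p → (p *ₚ []) ≋ []
  *ₚ-zeroʳ []      = ≋-refl
  *ₚ-zeroʳ (a ∷ p) = ≋-trans (∷-cong refl (*ₚ-zeroʳ p)) 0∷[]≋[]

  X-*ₚ : ∀ x q → ((X- x) *ₚ q) ≋ (((- x) ·ₚ q) +ₚ (0# ∷ q))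
  X-*ₚ x q = +ₚ-cong ≋-refl (∷-cong refl (*ₚ-identityˡ q))

  coeff-X-*ₚ : ∀ x q i → coeff ((X- x) *ₚ q) i ≈ (- x) * coeff q i + coeff (0# ∷ q) i
  coeff-X-*ₚ x q i = trans (at (X-*ₚ x q) i) (trans (coeff-+ₚ ((- x) ·ₚ q) (0# ∷ q) i) (+-congʳ (coeff-·ₚ (- x) q i)))

  coeff-from-X-*ₚ : ∀ x q i → coeff q i ≈ coeff ((X- x) *ₚ q) (suc i) + x * coeff q (suc i)
  coeff-from-X-*ₚ x q i = sym (begin
    coeff ((X- x) *ₚ q) (suc i) + x * a        ≈⟨ +-congʳ (coeff-X-*ₚ x q (suc i)) ⟩
    ((- x) * a + coeff q i) + x * a
      ≈⟨ solve 4 (λ n x a b → ((n ⊗ a ⊕ b) ⊕ x ⊗ a) ⊜ (b ⊕ (n ⊗ a ⊕ x ⊗ a))) refl (- x) x a (coeff q i) ⟩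
    coeff q i + ((- x) * a + x * a)           ≈⟨ +-congˡ (-x*y+x*y≈0 x a) ⟩
    coeff q i + 0#                            ≈⟨ +-identityʳ _ ⟩
    coeff q i                                 ∎)
    where
    a = coeff q (suc i)
    open ≈-Reasoning

  coeff-beyond : ∀ p {i} → length p ≤ i → coeff p i ≡ 0#
  coeff-beyond []      _         = ≡.refl
  coeff-beyond (a ∷ p) (s≤s len≤i) = coeff-beyond p len≤i

  X-*ₚ-cancelˡ : ∀ x {r r′} → ((X- x) *ₚ r) ≋ ((X- x) *ₚ r′) → r ≋ r′
  X-*ₚ-cancelˡ x {r} {r′} e = coeffwise λ i → descend L i (ℕ.m≤m+n L i)
    where
    L = length r ℕ.+ length r′
    -- downward induction on i, starting where both r and r′ have run out of coefficients
    descend : ∀ k i → L ≤ k ℕ.+ i → coeff r i ≈ coeff r′ i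
    descend zero    i L≤i = reflexive (≡.trans (coeff-beyond r (ℕ.≤-trans (ℕ.m≤m+n _ _) L≤i))
                                       (≡.sym (coeff-beyond r′ (ℕ.≤-trans (ℕ.m≤n+m _ _) L≤i))))
    descend (suc k) i L≤1+k+i = begin
      coeff r i                                            ≈⟨ coeff-from-X-*ₚ x r i ⟩
      coeff ((X- x) *ₚ r) (suc i) + x * coeff r (suc i)    ≈⟨ +-cong (at e (suc i)) (*-congˡ (descend k (suc i) L≤k+1+i)) ⟩
      coeff ((X- x) *ₚ r′) (suc i) + x * coeff r′ (suc i)  ≈⟨ coeff-from-X-*ₚ x r′ i ⟨
      coeff r′ i                                           ∎
      where
      open ≈-Reasoning
      L≤k+1+i : L ≤ k ℕ.+ suc i
      L≤k+1+i = ≡.subst (L ≤_) (≡.sym (ℕ.+-suc k i)) L≤1+k+i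

  eval : Carrier → Poly → Carrier
  eval x []      = 0#
  eval x (a ∷ p) = a + x * eval x p

  eval-≋[] : ∀ x p → p ≋ [] → eval x p ≈ 0#
  eval-≋[] x []      _   = refl
  eval-≋[] x (a ∷ p) p≋[] = begin
    a + x * eval x p  ≈⟨ +-cong (at p≋[] zero) (*-congˡ (eval-≋[] x p (coeffwise {q = []} (at p≋[] ∘ suc)))) ⟩
    0# + x * 0#       ≈⟨ trans (+-identityˡ _) (zeroʳ x) ⟩
    0#                ∎
    where open ≈-Reasoning

  eval-cong : ∀ x {p q} → p ≋ q → eval x p ≈ eval x q
  eval-cong x {[]}    {q}     e = sym (eval-≋[] x q (≋-sym e))
  eval-cong x {a ∷ p} {[]}    e = eval-≋[] x (a ∷ p) e
  eval-cong x {a ∷ p} {b ∷ q} e = +-cong (at e zero) (*-congˡ (eval-cong x (∷-injectiveʳ e)))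

  eval-+ₚ : ∀ x p q → eval x (p +ₚ q) ≈ eval x p + eval x q
  eval-+ₚ x []      q       = sym (+-identityˡ _)
  eval-+ₚ x (a ∷ p) []      = sym (+-identityʳ _)
  eval-+ₚ x (a ∷ p) (b ∷ q) = trans (+-congˡ (*-congˡ (eval-+ₚ x p q)))
    (solve 5 (λ a b x u v → ((a ⊕ b) ⊕ x ⊗ (u ⊕ v)) ⊜ ((a ⊕ x ⊗ u) ⊕ (b ⊕ x ⊗ v))) refl a b x (eval x p) (eval x q))

  eval-·ₚ : ∀ x a p → eval x (a ·ₚ p) ≈ a * eval x p
  eval-·ₚ x a []      = sym (zeroʳ a)
  eval-·ₚ x a (b ∷ p) = trans (+-congˡ (*-congˡ (eval-·ₚ x a p)))
    (solve 4 (λ a b x u → (a ⊗ b ⊕ x ⊗ (a ⊗ u)) ⊜ (a ⊗ (b ⊕ x ⊗ u))) refl a b x (eval x p))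

  eval-X-*ₚ : ∀ x q → eval x ((X- x) *ₚ q) ≈ 0#
  eval-X-*ₚ x q = begin
    eval x ((X- x) *ₚ q)                     ≈⟨ eval-cong x (X-*ₚ x q) ⟩
    eval x (((- x) ·ₚ q) +ₚ (0# ∷ q))        ≈⟨ eval-+ₚ x ((- x) ·ₚ q) (0# ∷ q) ⟩
    eval x ((- x) ·ₚ q) + (0# + x * eval x q) ≈⟨ +-cong (eval-·ₚ x (- x) q) (+-identityˡ _) ⟩
    (- x) * eval x q + x * eval x q          ≈⟨ -x*y+x*y≈0 x (eval x q) ⟩
    0#                                       ∎
    where open ≈-Reasoning

  ×-≈-×1* : ∀ n x → (n ·ℕ x) ≈ (n ·ℕ 1#) * x
  ×-≈-×1* n x = sym (trans (×-assoc-* n 1# x) (×-congʳ n (*-identityˡ x)))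

  coeff-derivAux : ∀ k p i → coeff (derivAux k p) i ≈ ((k ℕ.+ i) ·ℕ 1#) * coeff p i
  coeff-derivAux k []      i       = sym (zeroʳ _)
  coeff-derivAux k (a ∷ p) zero    rewrite ℕ.+-identityʳ k = ×-≈-×1* k a
  coeff-derivAux k (a ∷ p) (suc i) rewrite ℕ.+-suc k i     = coeff-derivAux (suc k) p i

  coeff-deriv : ∀ p i → coeff (deriv p) i ≈ (suc i ·ℕ 1#) * coeff p (suc i)
  coeff-deriv []      i = sym (zeroʳ _)
  coeff-deriv (a ∷ p) i = coeff-derivAux 1 p i

  deriv-cong : ∀ {p q} → p ≋ q → deriv p ≋ deriv q
  deriv-cong {p} {q} e = coeffwise λ i →
    trans (coeff-deriv p i) (trans (*-congˡ (at e (suc i))) (sym (coeff-deriv q i)))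

  deriv^-cong : ∀ j {p q} → p ≋ q → deriv^ j p ≋ deriv^ j q
  deriv^-cong zero    e = e
  deriv^-cong (suc j) e = deriv-cong (deriv^-cong j e)

  deriv-+ₚ : ∀ p q → deriv (p +ₚ q) ≋ (deriv p +ₚ deriv q)
  deriv-+ₚ p q = coeffwise at-i
    where
    at-i : ∀ i → coeff (deriv (p +ₚ q)) i ≈ coeff (deriv p +ₚ deriv q) i
    at-i i = begin
      coeff (deriv (p +ₚ q)) i                     ≈⟨ coeff-deriv (p +ₚ q) i ⟩
      n * coeff (p +ₚ q) (suc i)                   ≈⟨ *-congˡ (coeff-+ₚ p q (suc i)) ⟩
      n * (coeff p (suc i) + coeff q (suc i))      ≈⟨ distribˡ n _ _ ⟩
      n * coeff p (suc i) + n * coeff q (suc i)    ≈⟨ +-cong (coeff-deriv p i) (coeff-deriv q i) ⟨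
      coeff (deriv p) i + coeff (deriv q) i        ≈⟨ coeff-+ₚ (deriv p) (deriv q) i ⟨
      coeff (deriv p +ₚ deriv q) i                 ∎
      where
      n = suc i ·ℕ 1#
      open ≈-Reasoning

  deriv-·ₚ : ∀ a p → deriv (a ·ₚ p) ≋ (a ·ₚ deriv p)
  deriv-·ₚ a p = coeffwise at-i
    where
    at-i : ∀ i → coeff (deriv (a ·ₚ p)) i ≈ coeff (a ·ₚ deriv p) i
    at-i i = begin
      coeff (deriv (a ·ₚ p)) i    ≈⟨ coeff-deriv (a ·ₚ p) i ⟩
      n * coeff (a ·ₚ p) (suc i)  ≈⟨ *-congˡ (coeff-·ₚ a p (suc i)) ⟩
      n * (a * coeff p (suc i))   ≈⟨ solve 3 (λ n a b → (n ⊗ (a ⊗ b)) ⊜ (a ⊗ (n ⊗ b))) refl n a (coeff p (suc i)) ⟩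
      a * (n * coeff p (suc i))   ≈⟨ *-congˡ (coeff-deriv p i) ⟨
      a * coeff (deriv p) i       ≈⟨ coeff-·ₚ a (deriv p) i ⟨
      coeff (a ·ₚ deriv p) i      ∎
      where
      n = suc i ·ℕ 1#
      open ≈-Reasoning

  coeff-0∷deriv : ∀ q i → coeff (0# ∷ deriv q) i ≈ (i ·ℕ 1#) * coeff q i
  coeff-0∷deriv q zero    = sym (zeroˡ _)
  coeff-0∷deriv q (suc i) = coeff-deriv q i

  deriv-X-*ₚ : ∀ x q → deriv ((X- x) *ₚ q) ≋ (q +ₚ ((X- x) *ₚ deriv q))
  deriv-X-*ₚ x q = coeffwise at-i
    where
    at-i : ∀ i → coeff (deriv ((X- x) *ₚ q)) i ≈ coeff (q +ₚ ((X- x) *ₚ deriv q)) i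
    at-i i = begin
      coeff (deriv ((X- x) *ₚ q)) i                          ≈⟨ coeff-deriv ((X- x) *ₚ q) i ⟩
      (1# + m) * coeff ((X- x) *ₚ q) (suc i)                 ≈⟨ *-congˡ (coeff-X-*ₚ x q (suc i)) ⟩
      (1# + m) * ((- x) * a + b)
        ≈⟨ solve 5 (λ u m n a b → ((u ⊕ m) ⊗ (n ⊗ a ⊕ b)) ⊜ (u ⊗ b ⊕ (n ⊗ ((u ⊕ m) ⊗ a) ⊕ m ⊗ b))) refl 1# m (- x) a b ⟩
      1# * b + ((- x) * ((1# + m) * a) + m * b)              ≈⟨ +-congʳ (*-identityˡ b) ⟩
      b + ((- x) * ((1# + m) * a) + m * b)                   ≈⟨ +-congˡ (+-cong (*-congˡ (coeff-deriv q i)) (coeff-0∷deriv q i)) ⟨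
      b + ((- x) * coeff (deriv q) i + coeff (0# ∷ deriv q) i) ≈⟨ +-congˡ (coeff-X-*ₚ x (deriv q) i) ⟨
      b + coeff ((X- x) *ₚ deriv q) i                        ≈⟨ coeff-+ₚ q ((X- x) *ₚ deriv q) i ⟨
      coeff (q +ₚ ((X- x) *ₚ deriv q)) i                     ∎
      where
      m = i ·ℕ 1#
      a = coeff q (suc i)
      b = coeff q i
      open ≈-Reasoning

  deriv-X-^ : ∀ x k → deriv ((X- x) ^ₚ suc k) ≋ ((suc k ·ℕ 1#) ·ₚ ((X- x) ^ₚ k))
  deriv-X-^ x zero    = ≋-trans (deriv-X-*ₚ x oneₚ)
    (+ₚ-cong (∷-cong (sym (trans (*-identityʳ _) (+-identityʳ 1#))) ≋-refl) (*ₚ-zeroʳ (X- x)))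
  deriv-X-^ x (suc k) = begin
    deriv ((X- x) *ₚ P)                          ≈⟨ deriv-X-*ₚ x P ⟩
    P +ₚ ((X- x) *ₚ deriv P)                     ≈⟨ +ₚ-cong (≋-refl {P}) (*ₚ-congʳ (X- x) (deriv-X-^ x k)) ⟩
    P +ₚ ((X- x) *ₚ (n ·ₚ ((X- x) ^ₚ k)))        ≈⟨ +ₚ-cong (≋-sym (·ₚ-identityˡ P)) (*ₚ-·ₚʳ n (X- x) ((X- x) ^ₚ k)) ⟩
    (1# ·ₚ P) +ₚ (n ·ₚ P)                        ≈⟨ ·ₚ-distribʳ 1# n P ⟨
    ((1# + n) ·ₚ P)                              ∎
    where
    P = (X- x) ^ₚ suc k
    n = suc k ·ℕ 1#
    open ≋-Reasoning

  coeff-deriv≈0⇔ : CharZero → ∀ p i → (coeff (deriv p) i ≈ 0#) ⇔ (coeff p (suc i) ≈ 0#)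
  coeff-deriv≈0⇔ char0 p i = mk⇔
    (λ d≈0 → x≉0∧x*y≈0⇒y≈0 (char0 i) (trans (sym (coeff-deriv p i)) d≈0))
    (λ c≈0 → trans (coeff-deriv p i) (trans (*-congˡ c≈0) (zeroʳ _)))

  coeff-deriv^≈0⇔ : CharZero → ∀ j p i → (coeff (deriv^ j p) i ≈ 0#) ⇔ (coeff p (i ℕ.+ j) ≈ 0#)
  coeff-deriv^≈0⇔ char0 zero    p i rewrite ℕ.+-identityʳ i = ⇔-id _
  coeff-deriv^≈0⇔ char0 (suc j) p i rewrite ℕ.+-suc i j =
    coeff-deriv^≈0⇔ char0 j p (suc i) ⇔-∘ coeff-deriv≈0⇔ char0 (deriv^ j p) i

  coeff-tabulate : ∀ {m} (g : Fin m → Carrier) j → coeff (tabulate g) (toℕ j) ≡ g j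
  coeff-tabulate g fzero    = ≡.refl
  coeff-tabulate g (fsuc j) = coeff-tabulate (g ∘ fsuc) j

  ∣ₚ-respʳ : ∀ d {g g′} → g ≋ g′ → d ∣ₚ g → d ∣ₚ g′
  ∣ₚ-respʳ d g≋g′ (q , g≈dq) = q , at (≋-trans (≋-sym g≋g′) (coeffwise {q = d *ₚ q} g≈dq))

  module TaylorAt (lam : Carrier) where

    X-λ : Poly
    X-λ = X- lam

    taylorFrom : ℕ → List Carrier → Poly
    taylorFrom k []       = []
    taylorFrom k (d ∷ ds) = (d ·ₚ (X-λ ^ₚ k)) +ₚ taylorFrom (suc k) ds

    taylor : List Carrier → Poly
    taylor = taylorFrom 0

    taylorFrom-suc : ∀ k ds → taylorFrom (suc k) ds ≋ (X-λ *ₚ taylorFrom k ds)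
    taylorFrom-suc k []       = ≋-sym (*ₚ-zeroʳ X-λ)
    taylorFrom-suc k (d ∷ ds) =
      ≋-trans (+ₚ-cong (≋-sym (*ₚ-·ₚʳ d X-λ (X-λ ^ₚ k))) (taylorFrom-suc (suc k) ds))
        (≋-sym (*ₚ-distribˡ X-λ (d ·ₚ (X-λ ^ₚ k)) (taylorFrom (suc k) ds)))

    taylor-split : ∀ es → taylor es ≋ ((coeff es 0 ∷ []) +ₚ (X-λ *ₚ taylor (drop 1 es)))
    taylor-split []       = ≋-sym (+ₚ-cong 0∷[]≋[] (*ₚ-zeroʳ X-λ))
    taylor-split (e ∷ es) = +ₚ-cong (∷-cong (*-identityʳ e) ≋-refl) (taylorFrom-suc 0 es)

    taylor-split₀ : ∀ es → coeff es 0 ≈ 0# → taylor es ≋ (X-λ *ₚ taylor (drop 1 es))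
    taylor-split₀ es e₀≈0 = ≋-trans (taylor-split es) (+ₚ-cong (≋-trans (∷-cong e₀≈0 ≋-refl) 0∷[]≋[]) ≋-refl)

    eval-taylor : ∀ es → eval lam (taylor es) ≈ coeff es 0
    eval-taylor es = begin
      eval lam (taylor es)                            ≈⟨ eval-cong lam (taylor-split es) ⟩
      eval lam ((coeff es 0 ∷ []) +ₚ (X-λ *ₚ rest))  ≈⟨ eval-+ₚ lam (coeff es 0 ∷ []) (X-λ *ₚ rest) ⟩
      (coeff es 0 + lam * 0#) + eval lam (X-λ *ₚ rest) ≈⟨ +-cong (trans (+-congˡ (zeroʳ lam)) (+-identityʳ _)) (eval-X-*ₚ lam rest) ⟩
      coeff es 0 + 0#                                 ≈⟨ +-identityʳ _ ⟩
      coeff es 0                                      ∎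
      where
      rest = taylor (drop 1 es)
      open ≈-Reasoning

    X-λ^suc∣taylor⇔ : ∀ ν es → ((X-λ ^ₚ suc ν) ∣ₚ taylor es) ⇔ (coeff es 0 ≈ 0# × (X-λ ^ₚ ν) ∣ₚ taylor (drop 1 es))
    X-λ^suc∣taylor⇔ ν es = mk⇔ to′ from′
      where
      to′ : (X-λ ^ₚ suc ν) ∣ₚ taylor es → coeff es 0 ≈ 0# × (X-λ ^ₚ ν) ∣ₚ taylor (drop 1 es)
      to′ (q , e) = e₀≈0 , q , at (X-*ₚ-cancelˡ lam (≋-trans (≋-sym (taylor-split₀ es e₀≈0)) taylor≋))
        where
        taylor≋ : taylor es ≋ (X-λ *ₚ ((X-λ ^ₚ ν) *ₚ q))
        taylor≋ = ≋-trans (coeffwise e) (*ₚ-assoc X-λ (X-λ ^ₚ ν) q)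
        e₀≈0 : coeff es 0 ≈ 0#
        e₀≈0 = trans (sym (eval-taylor es)) (trans (eval-cong lam taylor≋) (eval-X-*ₚ lam ((X-λ ^ₚ ν) *ₚ q)))
      from′ : coeff es 0 ≈ 0# × (X-λ ^ₚ ν) ∣ₚ taylor (drop 1 es) → (X-λ ^ₚ suc ν) ∣ₚ taylor es
      from′ (e₀≈0 , q , e) = q , at (≋-trans (taylor-split₀ es e₀≈0)
                                   (≋-trans (*ₚ-congʳ X-λ (coeffwise e)) (≋-sym (*ₚ-assoc X-λ (X-λ ^ₚ ν) q))))

    X-λ^∣taylor⇔ : ∀ ν es → ((X-λ ^ₚ ν) ∣ₚ taylor es) ⇔ AllBelow (λ i → coeff es i ≈ 0#) ν
    X-λ^∣taylor⇔ zero    es = mk⇔ (λ _ _ ()) (λ _ → taylor es , at (≋-sym (*ₚ-identityˡ (taylor es))))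
    X-λ^∣taylor⇔ (suc ν) es = ⇔-sym AllBelow-suc⇔ ⇔-∘ ((⇔-id _ ×-⇔ drop₁ es) ⇔-∘ X-λ^suc∣taylor⇔ ν es)
      where
      drop₁ : ∀ es → ((X-λ ^ₚ ν) ∣ₚ taylor (drop 1 es)) ⇔ AllBelow (λ i → coeff es (suc i) ≈ 0#) ν
      drop₁ []       = X-λ^∣taylor⇔ ν []
      drop₁ (e ∷ es) = X-λ^∣taylor⇔ ν es

    IsMultiplicity-taylor⇔ : ∀ es μ → IsMultiplicity (taylor es) lam μ ⇔ RunLength (λ i → coeff es i ≈ 0#) μ
    IsMultiplicity-taylor⇔ es = greatest⇔RunLength (λ ν → X-λ^∣taylor⇔ ν es)

    IsMultiplicity-resp : ∀ {g g′ μ} → g ≋ g′ → IsMultiplicity g lam μ → IsMultiplicity g′ lam μ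
    IsMultiplicity-resp {μ = μ} g≋g′ (divides , greatest) =
      ∣ₚ-respʳ (X-λ ^ₚ μ) g≋g′ divides , λ ν d → greatest ν (∣ₚ-respʳ (X-λ ^ₚ ν) (≋-sym g≋g′) d)

    IsMultiplicity-cong : ∀ {g g′ μ} → g ≋ g′ → IsMultiplicity g lam μ ⇔ IsMultiplicity g′ lam μ
    IsMultiplicity-cong g≋g′ = mk⇔ (IsMultiplicity-resp g≋g′) (IsMultiplicity-resp (≋-sym g≋g′))

    deriv-taylorFrom : ∀ k es → deriv (taylorFrom (suc k) es) ≋ taylorFrom k (derivAux (suc k) es)
    deriv-taylorFrom k []       = ≋-refl
    deriv-taylorFrom k (e ∷ es) = begin
      deriv ((e ·ₚ (X-λ ^ₚ suc k)) +ₚ taylorFrom (suc (suc k)) es)           ≈⟨ deriv-+ₚ (e ·ₚ (X-λ ^ₚ suc k)) _ ⟩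
      deriv (e ·ₚ (X-λ ^ₚ suc k)) +ₚ deriv (taylorFrom (suc (suc k)) es)
        ≈⟨ +ₚ-cong (deriv-·ₚ e (X-λ ^ₚ suc k)) (deriv-taylorFrom (suc k) es) ⟩
      (e ·ₚ deriv (X-λ ^ₚ suc k)) +ₚ taylorFrom (suc k) (derivAux (suc (suc k)) es)
        ≈⟨ +ₚ-cong (·ₚ-cong refl (deriv-X-^ lam k)) ≋-refl ⟩
      (e ·ₚ (n ·ₚ (X-λ ^ₚ k))) +ₚ taylorFrom (suc k) (derivAux (suc (suc k)) es)
        ≈⟨ +ₚ-cong (≋-trans (·ₚ-assoc e n (X-λ ^ₚ k)) (·ₚ-cong e*n≈n·e ≋-refl)) ≋-refl ⟩
      ((suc k ·ℕ e) ·ₚ (X-λ ^ₚ k)) +ₚ taylorFrom (suc k) (derivAux (suc (suc k)) es) ∎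
      where
      n = suc k ·ℕ 1#
      e*n≈n·e : e * n ≈ (suc k ·ℕ e)
      e*n≈n·e = trans (*-comm e n) (sym (×-≈-×1* (suc k) e))
      open ≋-Reasoning

    deriv^-taylor : ∀ j es → deriv^ j (taylor es) ≋ taylor (deriv^ j es)
    deriv^-taylor zero    es = ≋-refl
    deriv^-taylor (suc j) es = ≋-trans (deriv-cong (deriv^-taylor j es)) (deriv-taylor (deriv^ j es))
      where
      deriv-taylor : ∀ es → deriv (taylor es) ≋ taylor (deriv es)
      deriv-taylor []       = ≋-refl
      deriv-taylor (e ∷ es) = ≋-trans (deriv-+ₚ (e ·ₚ oneₚ) (taylorFrom 1 es)) (deriv-taylorFrom 0 es)

    shiftedPoly≡taylor : ∀ {n} (cs : Fin (suc n) → Carrier) → shiftedPoly lam cs ≡ taylor (tabulate cs)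
    shiftedPoly≡taylor cs = foldr-tabulate id 0 (λ _ → ≡.refl)
      where
      foldr-tabulate : ∀ {m} (g : Fin m → Fin _) k → (∀ i → toℕ (g i) ≡ k ℕ.+ toℕ i) →
                       foldr (λ j acc → (cs j ·ₚ (X-λ ^ₚ toℕ j)) +ₚ acc) [] (tabulate g) ≡ taylorFrom k (tabulate (cs ∘ g))
      foldr-tabulate {zero}  g k toℕ-g = ≡.refl
      foldr-tabulate {suc m} g k toℕ-g = ≡.cong₂ _+ₚ_
        (≡.cong (λ t → cs (g fzero) ·ₚ (X-λ ^ₚ t)) (≡.trans (toℕ-g fzero) (ℕ.+-identityʳ k)))
        (foldr-tabulate (g ∘ fsuc) (suc k) λ i → ≡.trans (toℕ-g (fsuc i)) (ℕ.+-suc k (toℕ i)))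

    IsMultiplicity-deriv^-shiftedPoly⇔ : CharZero → ∀ {n} (cs : Fin (suc n) → Carrier) j μ →
      IsMultiplicity (deriv^ j (shiftedPoly lam cs)) lam μ ⇔ RunLength (λ i → coeff (tabulate cs) (i ℕ.+ j) ≈ 0#) μ
    IsMultiplicity-deriv^-shiftedPoly⇔ char0 cs j μ = begin
      IsMultiplicity (deriv^ j (shiftedPoly lam cs)) lam μ       ∼⟨ IsMultiplicity-cong shifted≋ ⟩
      IsMultiplicity (taylor (deriv^ j (tabulate cs))) lam μ     ∼⟨ IsMultiplicity-taylor⇔ (deriv^ j (tabulate cs)) μ ⟩
      RunLength (λ i → coeff (deriv^ j (tabulate cs)) i ≈ 0#) μ  ∼⟨ RunLength-cong (coeff-deriv^≈0⇔ char0 j (tabulate cs)) ⟩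
      RunLength (λ i → coeff (tabulate cs) (i ℕ.+ j) ≈ 0#) μ     ∎
      where
      shifted≋ : deriv^ j (shiftedPoly lam cs) ≋ taylor (deriv^ j (tabulate cs))
      shifted≋ = ≋-trans (deriv^-cong j (≋-reflexive (shiftedPoly≡taylor cs))) (deriv^-taylor j (tabulate cs))
      open EquationalReasoning

theorem2 : {c ℓ : Level} (K : Field c ℓ) → FieldTheory.CharZero K →
  {n : ℕ} (M : Fin (suc n) → ℕ) → IsMultiplicityVector M →
  (lam : Field.Carrier K) (cs : Fin (suc n) → Field.Carrier K) →
  FieldTheory.HasDegree K (FieldTheory.shiftedPoly K lam cs) n →
  FieldTheory.IsMultVectorOf K M (FieldTheory.shiftedPoly K lam cs) lam
    ⇔ (∀ (j : Fin (suc n)) → (Field._≈_ K (cs j) (Field.0# K) ⇔ 1 ≤ M j))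
theorem2 K char0 M isMV lam cs _ = begin
  IsMultVectorOf M (shiftedPoly lam cs) lam        ∼⟨ ∀-⇔ (λ j → IsMultiplicity-deriv^-shiftedPoly⇔ char0 cs (toℕ j) (M j)) ⟩
  (∀ j → RunLength (λ i → Z (i ℕ.+ toℕ j)) (M j))  ∼⟨ runLengths⇔heads isMV {Z} ⟩
  (∀ j → Z (toℕ j) ⇔ 1 ≤ M j)                      ∼⟨ ∀-⇔ (λ j → K-reflexive (≡.cong (λ c → c ≈ 0# ⇔ 1 ≤ M j)
                                                                                   (coeff-tabulate cs j))) ⟩
  (∀ j → cs j ≈ 0# ⇔ 1 ≤ M j)                      ∎
  where
  open Field K
  open FieldTheory K
  open Polynomials K
  open TaylorAt lam
  open EquationalReasoning
  Z : ℕ → Set _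
  Z k = coeff (tabulate cs) k ≈ 0#
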